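{- Let $n\ge 1$ and let $a=(a_0,a_1,\ldots,a_{2n-1})$ be a sequence of $2n$ natural numbers with $\sum_{k=0}^{2n-1}a_k\le n-1$. Then there is an even index $i\in\{0,\ldots,2n-1\}$ such that, setting $b^{(i)}_j=a_{(i+j)\bmod 2n}$ for $j\ge 0$ and $B^{(i)}_j=\sum_{k=0}^{j-1}b^{(i)}_k$, we have $B^{(i)}_j<\frac{j}{2}$ for all integers $j>0$. -}

module Defs where

open import Data.Nat using (ℕ; zero; suc; _+_; _*_)
open import Data.Nat.DivMod using (_mod_)
open import Data.Fin using (Fin)

partialSum : (ℕ → ℕ) → ℕ → ℕ
partialSum f zero    = 0
partialSum f (suc j) = partialSum f j + f j

-- cyclic reading of a sequence of length 2n: cyc n a k = a_(k mod 2n).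
-- For n = 0 there are no entries; we return 0 (this case is excluded by n ≥ 1).
cyc : (n : ℕ) → (Fin (2 * n) → ℕ) → ℕ → ℕ
cyc zero    a k = 0
cyc (suc m) a k = a (k mod (2 * suc m))

shifted : (n : ℕ) → (Fin (2 * n) → ℕ) → ℕ → ℕ → ℕ
shifted n a i j = cyc n a (i + j)

-- Write S for the partial sums of the cyclic sequence and call p - S(2p) the
-- excess at the even position 2p.  Moving one period (n pairs) to the right
-- changes the excess by n - S(2n) > 0.  Let m be the last position in [0, n)
-- of minimal excess; then every later position, also beyond the first period,
-- has strictly larger excess.  Read from i = 2m, this says that the first 2t
-- terms sum to less than t, and the odd lengths follow by monotonicity.
module Submission where

open import Defs
open import Level using (0ℓ)
open import Data.Nat using (ℕ; zero; suc; _+_; _*_; _≤_; _<_; _∸_; _≤?_; _<?_; z≤n; s≤s; s≤s⁻¹; z<s)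
open import Data.Nat.Properties
open import Data.Nat.DivMod using (_%_; [m+n]%n≡m%n; m%n<n)
open import Data.Nat.Induction using (<-rec)
open import Data.Nat.Tactic.RingSolver using (solve-∀)
open import Data.Fin using (Fin)
open import Data.Fin.Properties using (fromℕ<-cong)
open import Data.Product using (∃; _×_; _,_)
open import Data.Sum using (_⊎_; inj₁; inj₂)
open import Relation.Nullary using (¬_; yes; no; contradiction)
open import Relation.Binary.Core using (Rel)
open import Relation.Binary.Definitions using (Transitive; Total; Decidable)
open import Relation.Binary.PropositionalEquality

partialSum-cong : ∀ {f g} → (∀ k → f k ≡ g k) → ∀ j → partialSum f j ≡ partialSum g j
partialSum-cong f≗g zero    = refl
partialSum-cong f≗g (suc j) = cong₂ _+_ (partialSum-cong f≗g j) (f≗g j)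

partialSum-+ : ∀ f i j →
  partialSum f (i + j) ≡ partialSum f i + partialSum (λ k → f (i + k)) j
partialSum-+ f i zero    = trans (cong (partialSum f) (+-identityʳ i)) (sym (+-identityʳ _))
partialSum-+ f i (suc j) = begin
  partialSum f (i + suc j)                          ≡⟨ cong (partialSum f) (+-suc i j) ⟩
  partialSum f (i + j) + f (i + j)                  ≡⟨ cong (_+ f (i + j)) (partialSum-+ f i j) ⟩
  partialSum f i + partialSum f[i+_] j + f (i + j)  ≡⟨ +-assoc (partialSum f i) _ _ ⟩
  partialSum f i + partialSum f[i+_] (suc j)        ∎
  where
  open ≡-Reasoning
  f[i+_] : ℕ → ℕ
  f[i+_] k = f (i + k)

partialSum-periodic : ∀ {f} N → (∀ k → f (N + k) ≡ f k) →
  ∀ k → partialSum f (N + k) ≡ partialSum f N + partialSum f k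
partialSum-periodic {f} N f-per k =
  trans (partialSum-+ f N k) (cong (partialSum f N +_) (partialSum-cong f-per k))

cyc-periodic : ∀ n' a k → cyc (suc n') a (2 * suc n' + k) ≡ cyc (suc n') a k
cyc-periodic n' a k = cong a (fromℕ<-cong _ _ N+k%N≡k%N (m%n<n (N + k) N) (m%n<n k N))
  where
  N = 2 * suc n'
  N+k%N≡k%N : (N + k) % N ≡ k % N
  N+k%N≡k%N = trans (cong (_% N) (+-comm N k)) ([m+n]%n≡m%n k N)

even-or-odd : ∀ j → ∃ λ t → j ≡ 2 * t ⊎ j ≡ suc (2 * t)
even-or-odd zero = 0 , inj₁ refl
even-or-odd (suc j) with even-or-odd j
... | t , inj₁ refl = t , inj₂ refl
... | t , inj₂ refl = suc t , inj₁ (sym (*-suc 2 t))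

double-partialSum-< : ∀ {g} → (∀ t → 0 < t → partialSum g (2 * t) < t) →
  ∀ j → 0 < j → 2 * partialSum g j < j
double-partialSum-< {g} even-bound j 0<j with even-or-odd j
... | t , inj₁ refl = *-monoʳ-< 2 (even-bound t (*-cancelˡ-< 2 0 t 0<j))
... | t , inj₂ refl = s≤s (*-monoʳ-≤ 2 odd-bound)
  where
  odd-bound : partialSum g (suc (2 * t)) ≤ t
  odd-bound = s≤s⁻¹ (≤-<-trans
    (subst (partialSum g (suc (2 * t)) ≤_) (cong (partialSum g) (sym (*-suc 2 t)))
      (m≤m+n _ _))
    (even-bound (suc t) z<s))

lastMinimum : ∀ {ℓ} {_≲_ : Rel ℕ ℓ} → Transitive _≲_ → Total _≲_ → Decidable _≲_ →
  ∀ k → ∃ λ m → m < suc k × (∀ p → p < suc k → m ≲ p) ×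
                 (∀ p → m < p → p < suc k → ¬ p ≲ m)
lastMinimum {_≲_ = _≲_} ≲-trans ≲-total _≲?_ = go
  where
  ≲-refl : ∀ {p} → p ≲ p
  ≲-refl {p} with ≲-total p p
  ... | inj₁ p≲p = p≲p
  ... | inj₂ p≲p = p≲p

  go : ∀ k → ∃ λ m → m < suc k × (∀ p → p < suc k → m ≲ p) ×
                      (∀ p → m < p → p < suc k → ¬ p ≲ m)
  go zero = 0 , z<s , (λ { zero _ → ≲-refl ; (suc _) (s≤s ()) }) ,
            λ p 0<p p<1 _ → <⇒≱ 0<p (s≤s⁻¹ p<1)
  go (suc k) with go k
  ... | m , m<1+k , m-min , m-last with suc k ≲? m
  ...   | yes k+1≲m = suc k , ≤-refl , new-min , λ p k+1<p p<k+2 _ → <⇒≱ k+1<p (s≤s⁻¹ p<k+2)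
    where
    new-min : ∀ p → p < suc (suc k) → suc k ≲ p
    new-min p (s≤s p≤k+1) with m≤n⇒m<n∨m≡n p≤k+1
    ... | inj₁ p<k+1 = ≲-trans k+1≲m (m-min p p<k+1)
    ... | inj₂ refl  = ≲-refl
  ...   | no k+1≴m = m , m<n⇒m<1+n m<1+k , old-min , old-last
    where
    old-min : ∀ p → p < suc (suc k) → m ≲ p
    old-min p (s≤s p≤k+1) with m≤n⇒m<n∨m≡n p≤k+1 | ≲-total m p
    ... | inj₁ p<k+1 | _        = m-min p p<k+1
    ... | inj₂ refl  | inj₁ m≲p = m≲p
    ... | inj₂ refl  | inj₂ p≲m = contradiction p≲m k+1≴m
    old-last : ∀ p → m < p → p < suc (suc k) → ¬ p ≲ m
    old-last p m<p (s≤s p≤k+1) with m≤n⇒m<n∨m≡n p≤k+1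
    ... | inj₁ p<k+1 = m-last p m<p p<k+1
    ... | inj₂ refl  = k+1≴m

module Excess (w : ℕ → ℕ) where

  -- p ≼ q compares the excesses p - w p ≤ q - w q, kept free of truncated subtraction.
  _≼_ : Rel ℕ 0ℓ
  p ≼ q = p + w q ≤ q + w p

  _≺_ : Rel ℕ 0ℓ
  p ≺ q = p + w q < q + w p

  ≼-trans : Transitive _≼_
  ≼-trans {p} {q} {r} p≼q q≼r = +-cancelʳ-≤ (q + w q) _ _ (begin
    p + w r + (q + w q)    ≡⟨ regroupˡ p (w r) q (w q) ⟩
    p + w q + (q + w r)    ≤⟨ +-mono-≤ p≼q q≼r ⟩
    q + w p + (r + w q)    ≡⟨ regroupʳ q (w p) r (w q) ⟩
    r + w p + (q + w q)    ∎)
    where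
    open ≤-Reasoning
    regroupˡ : ∀ a b c d → a + b + (c + d) ≡ a + d + (c + b)
    regroupˡ = solve-∀
    regroupʳ : ∀ a b c d → a + b + (c + d) ≡ c + b + (a + d)
    regroupʳ = solve-∀

  ≼-total : Total _≼_
  ≼-total p q = ≤-total (p + w q) (q + w p)

  _≼?_ : Decidable _≼_
  p ≼? q = p + w q ≤? q + w p

  ≺-gain : ∀ {m t d} → w (m + t) ≡ w m + d → m ≺ (m + t) → d < t
  ≺-gain {m} {t} {d} w-step m≺m+t = +-cancelˡ-< (m + w m) d t (begin-strict
    m + w m + d            ≡⟨ +-assoc m (w m) d ⟩
    m + (w m + d)          ≡⟨ cong (m +_) w-step ⟨
    m + w (m + t)          <⟨ m≺m+t ⟩
    m + t + w m            ≡⟨ +-assoc m t (w m) ⟩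
    m + (t + w m)          ≡⟨ cong (m +_) (+-comm t (w m)) ⟩
    m + (w m + t)          ≡⟨ +-assoc m (w m) t ⟨
    m + w m + t            ∎)
    where open ≤-Reasoning

  -- One period raises the excess by n - T > 0, so a minimum over [0, n) is global.
  module Drift (n T : ℕ) (T<n : T < n) (w-shift : ∀ p → w (n + p) ≡ T + w p)
               {m : ℕ} (m-min : ∀ p → p < n → m ≼ p)
               (m-last : ∀ p → m < p → p < n → ¬ p ≼ m) where

    ≼-next-period : ∀ {p} → m ≼ p → m ≺ (n + p)
    ≼-next-period {p} m≼p = begin-strict
      m + w (n + p)          ≡⟨ cong (m +_) (w-shift p) ⟩
      m + (T + w p)          ≡⟨ x+[y+z]≡y+[x+z] m T (w p) ⟩
      T + (m + w p)          <⟨ +-mono-<-≤ T<n m≼p ⟩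
      n + (p + w m)          ≡⟨ +-assoc n p (w m) ⟨
      n + p + w m            ∎
      where
      open ≤-Reasoning
      x+[y+z]≡y+[x+z] : ∀ x y z → x + (y + z) ≡ y + (x + z)
      x+[y+z]≡y+[x+z] = solve-∀

    period-decomposition : ∀ {p} → ¬ p < n → ∃ λ o → o < p × n + o ≡ p
    period-decomposition p≮n with m≤n⇒∃[o]m+o≡n (≮⇒≥ p≮n)
    ... | o , refl = o , m<n+m o (≤-<-trans z≤n T<n) , refl

    ≼-everywhere : ∀ p → m ≼ p
    ≼-everywhere = <-rec (m ≼_) step
      where
      step : ∀ p → (∀ {o} → o < p → m ≼ o) → m ≼ p
      step p rec with p <? n
      ... | yes p<n = m-min p p<n
      ... | no p≮n with period-decomposition p≮n
      ...   | o , o<p , refl = <⇒≤ (≼-next-period (rec o<p))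

    ≺-after : ∀ p → m < p → m ≺ p
    ≺-after p m<p with p <? n
    ... | yes p<n = ≰⇒> (m-last p m<p p<n)
    ... | no p≮n with period-decomposition p≮n
    ...   | o , _ , refl = ≼-next-period (≼-everywhere o)

module EvenStart (n' : ℕ) (a : Fin (2 * suc n') → ℕ) where

  n : ℕ
  n = suc n'

  S : ℕ → ℕ
  S = partialSum (cyc n a)

  w : ℕ → ℕ
  w p = S (2 * p)

  open Excess w public

  w-shift : ∀ p → w (n + p) ≡ S (2 * n) + w p
  w-shift p = trans (cong S (*-distribˡ-+ 2 n p))
                    (partialSum-periodic (2 * n) (cyc-periodic n' a) (2 * p))

  w-step : ∀ m t → w (m + t) ≡ w m + partialSum (shifted n a (2 * m)) (2 * t)
  w-step m t = trans (cong S (*-distribˡ-+ 2 m t)) (partialSum-+ (cyc n a) (2 * m) (2 * t))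

  last-excess-minimum : ∃ λ m → m < n × (∀ p → p < n → m ≼ p) × (∀ p → m < p → p < n → ¬ p ≼ m)
  -- η-expanded because _≼_ is not injective, so its implicit arguments are not inferable.
  last-excess-minimum = lastMinimum (λ {p q r} → ≼-trans {p} {q} {r}) ≼-total _≼?_ n'

  balanced-after-last-minimum : S (2 * n) < n → ∀ {m} →
    (∀ p → p < n → m ≼ p) → (∀ p → m < p → p < n → ¬ p ≼ m) →
    ∀ t → 0 < t → partialSum (shifted n a (2 * m)) (2 * t) < t
  balanced-after-last-minimum T<n {m} m-min m-last t 0<t =
    ≺-gain {m} (w-step m t) (≺-after (m + t) (m<m+n m 0<t))
    where open Drift n (S (2 * n)) T<n w-shift m-min m-last

mainTheorem9 : (n : ℕ) → 1 ≤ n → (a : Fin (2 * n) → ℕ) →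
    partialSum (cyc n a) (2 * n) ≤ n ∸ 1 →
    ∃ λ (i : ℕ) → i < 2 * n × (∃ λ (m : ℕ) → i ≡ 2 * m) ×
      ((j : ℕ) → 0 < j → 2 * partialSum (shifted n a i) j < j)
mainTheorem9 (suc n') _ a T≤n' with EvenStart.last-excess-minimum n' a
... | m , m<n , m-min , m-last =
  2 * m , *-monoʳ-< 2 m<n , (m , refl) ,
  double-partialSum-< (balanced-after-last-minimum (s≤s T≤n') m-min m-last)
  where open EvenStart n' a
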